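{- Let $n\ge 1$ and $A\subseteq[n]$. Then the domain $D_{[n]}(A)$ is connected: for any two orders $x,y\in D_{[n]}(A)$ there is a sequence of orders $x=x_0,x_1,\dots,x_m=y$, all belonging to $D_{[n]}(A)$, such that each $x_{t+1}$ is obtained from $x_t$ by transposing two alternatives that are adjacent in $x_t$.
   Context: The set of alternatives is $[n]=\{1,\dots,n\}$, with its natural order as societal axis. For a triple $i<j<k$, the never condition $1N3$ on a set of linear orders means that in every order, $i$ is not ranked last among $i,j,k$; $3N1$ means that $k$ is not ranked first among $i,j,k$. For $A\subseteq[n]$, the set-alternating scheme generated by $A$ assigns to each triple $i<j<k$ the condition $1N3$ if $j\in A$ and $3N1$ if $j\notin A$; $D_{[n]}(A)$ is the set of all linear orders on $[n]$ satisfying all assigned conditions. -}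

module Defs where

open import Data.Nat using (ℕ)
open import Data.Fin using (Fin; _<_)
open import Data.Fin.Subset using (Subset; _∈_; _∉_)
open import Data.List using (List; _∷_; _++_; allFin)
open import Data.List.Relation.Binary.Permutation.Propositional using (_↭_)
open import Data.Product using (_×_; ∃-syntax)
open import Relation.Binary.PropositionalEquality using (_≡_)
open import Relation.Nullary using (¬_)
open import Relation.Binary.Construct.Closure.ReflexiveTransitive using (Star)

-- A linear order on [n] (alternatives Fin n, natural order = societal axis)
-- is a ranking list, most preferred first, that is a permutation of all alternatives.
IsLinearOrder : {n : ℕ} → List (Fin n) → Set
IsLinearOrder {n} σ = σ ↭ allFin n

Above : {n : ℕ} → List (Fin n) → Fin n → Fin n → Set
Above σ a b = ∃[ xs ] ∃[ ys ] ∃[ zs ] (σ ≡ xs ++ a ∷ ys ++ b ∷ zs)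

Never1-3 : {n : ℕ} → List (Fin n) → Fin n → Fin n → Fin n → Set
Never1-3 σ i j k = ¬ (Above σ j i × Above σ k i)

Never3-1 : {n : ℕ} → List (Fin n) → Fin n → Fin n → Fin n → Set
Never3-1 σ i j k = ¬ (Above σ k i × Above σ k j)

SatisfiesScheme : {n : ℕ} → Subset n → List (Fin n) → Set
SatisfiesScheme {n} A σ =
  (i j k : Fin n) → i < j → j < k →
    (j ∈ A → Never1-3 σ i j k) × (j ∉ A → Never3-1 σ i j k)

InDomain : {n : ℕ} → Subset n → List (Fin n) → Set
InDomain A σ = IsLinearOrder σ × SatisfiesScheme A σ

AdjSwap : {n : ℕ} → List (Fin n) → List (Fin n) → Set
AdjSwap σ τ = ∃[ xs ] ∃[ a ] ∃[ b ] ∃[ ys ]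
  ((σ ≡ xs ++ a ∷ b ∷ ys) × (τ ≡ xs ++ b ∷ a ∷ ys))

DomainStep : {n : ℕ} → Subset n → List (Fin n) → List (Fin n) → Set
DomainStep A σ τ = InDomain A σ × InDomain A τ × AdjSwap σ τ

ConnectedIn : {n : ℕ} → Subset n → List (Fin n) → List (Fin n) → Set
ConnectedIn A = Star (DomainStep A)

{-# OPTIONS --safe #-}
-- Every condition of the scheme, 1N3 as well as 3N1, forbids a configuration made
-- only of inverted pairs (a larger alternative above a smaller one). Hence an adjacent
-- transposition that puts an inverted pair into the natural order keeps an order in
-- the domain, and insertion sort, carried out by such transpositions, moves every
-- order of the domain inside the domain to the identity order 1 2 … n. Two orders
-- are connected through this common target.
module Submission where

open import Defs
open import Data.Nat using (ℕ; _≤_)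
open import Data.Fin.Subset using (Subset)
open import Data.List using (List)
open import Data.Fin using (Fin)

open import Data.Fin using (_<_) renaming (_≤_ to _≤ᶠ_)
open import Data.Fin.Properties using (<-trans; ≤-decTotalOrder; ≤-totalOrder)
open import Data.Nat.Properties using (<⇒≤)
open import Data.List using ([]; _∷_; _++_)
open import Data.List.Membership.Propositional using () renaming (_∈_ to _∈ₗ_)
open import Data.List.Membership.Propositional.Properties using (∈-∃++; ∈-++⁺ʳ)
open import Data.List.Relation.Unary.Any using (here; there)
open import Data.List.Relation.Binary.Equality.Propositional using (≋⇒≡)
open import Data.List.Relation.Binary.Permutation.Propositional
  using (_↭_; refl; prep; swap; ↭-sym; ↭-trans; ↭⇒↭ₛ)
open import Data.List.Relation.Binary.Permutation.Propositional.Properties using (∈-resp-↭)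
open import Data.List.Relation.Unary.Sorted.TotalOrder.Properties using (↗↭↗⇒≋)
open import Data.Product using (_,_; proj₁; proj₂)
open import Data.Sum using (_⊎_; inj₁; inj₂)
open import Level using (_⊔_)
open import Relation.Nullary using (¬_; yes; no; contradiction)
open import Relation.Binary.Bundles using (DecTotalOrder)
open import Relation.Binary.PropositionalEquality using (_≡_; refl; subst)
open import Relation.Binary.Construct.Closure.ReflexiveTransitive
  using (Star; ε; _◅_; _◅◅_; gmap; reverse)

module Untangling {a ℓ₁ ℓ₂} (O : DecTotalOrder a ℓ₁ ℓ₂) where

  open DecTotalOrder O using (_≤?_) renaming (Carrier to X; _≤_ to _≼_)
  open import Data.List.Sort.InsertionSort O using (insert; sort)

  data Untangle : List X → List X → Set (a ⊔ ℓ₂) where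
    here  : ∀ {x y σ} → ¬ x ≼ y → Untangle (x ∷ y ∷ σ) (y ∷ x ∷ σ)
    there : ∀ {w σ τ} → Untangle σ τ → Untangle (w ∷ σ) (w ∷ τ)

  Untangle⇒↭ : ∀ {σ τ} → Untangle σ τ → τ ↭ σ
  Untangle⇒↭ (here {x} {y} _)  = swap y x refl
  Untangle⇒↭ (there {w} step) = prep w (Untangle⇒↭ step)

  untangling-∷ : ∀ {w σ τ} → Star Untangle σ τ → Star Untangle (w ∷ σ) (w ∷ τ)
  untangling-∷ = gmap (_ ∷_) there

  insert-untangling : ∀ x σ → Star Untangle (x ∷ σ) (insert x σ)
  insert-untangling x []      = ε
  insert-untangling x (y ∷ σ) with x ≤? y
  ... | yes _   = ε
  ... | no  x≰y = here x≰y ◅ untangling-∷ (insert-untangling x σ)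

  sort-untangling : ∀ σ → Star Untangle σ (sort σ)
  sort-untangling []      = ε
  sort-untangling (x ∷ σ) = untangling-∷ (sort-untangling σ) ◅◅ insert-untangling x (sort σ)

module _ {n : ℕ} where

  open import Data.List.Sort.InsertionSort (≤-decTotalOrder n) using (sort)
  open import Data.List.Sort.InsertionSort.Properties (≤-decTotalOrder n) using (sort-↭; sort-↗)
  open Untangling (≤-decTotalOrder n)

  data Precedes : List (Fin n) → Fin n → Fin n → Set where
    here  : ∀ {u v σ} → v ∈ₗ σ → Precedes (u ∷ σ) u v
    there : ∀ {u v w σ} → Precedes σ u v → Precedes (w ∷ σ) u v

  Above⇒Precedes : ∀ {σ u v} → Above σ u v → Precedes σ u v
  Above⇒Precedes (xs , ys , zs , refl) = go xs
    where
    go : ∀ xs {u ys v zs} → Precedes (xs ++ u ∷ ys ++ v ∷ zs) u v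
    go []       {ys = ys} = here (∈-++⁺ʳ ys (here refl))
    go (x ∷ xs) = there (go xs)

  Precedes⇒Above : ∀ {σ u v} → Precedes σ u v → Above σ u v
  Precedes⇒Above (here v∈σ) with ∈-∃++ v∈σ
  ... | ys , zs , refl = [] , ys , zs , refl
  Precedes⇒Above {σ = w ∷ _} (there p) with Precedes⇒Above p
  ... | xs , ys , zs , refl = w ∷ xs , ys , zs , refl

  InversionsIncluded : List (Fin n) → List (Fin n) → Set
  InversionsIncluded τ σ = ∀ {u v} → v < u → Above τ u v → Above σ u v

  SatisfiesScheme-antitone : ∀ {A σ τ} → InversionsIncluded τ σ →
                             SatisfiesScheme A σ → SatisfiesScheme A τ
  SatisfiesScheme-antitone τ⊆σ sat i j k i<j j<k =
    (λ j∈A (j>i , k>i) → proj₁ (sat i j k i<j j<k) j∈A (τ⊆σ i<j j>i , τ⊆σ i<k k>i)) ,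
    (λ j∉A (k>i , k>j) → proj₂ (sat i j k i<j j<k) j∉A (τ⊆σ i<k k>i , τ⊆σ j<k k>j))
    where
    i<k : i < k
    i<k = <-trans i<j j<k

  Untangle⇒AdjSwap : ∀ {σ τ} → Untangle σ τ → AdjSwap σ τ
  Untangle⇒AdjSwap (here {a} {b} {σ} _) = [] , a , b , σ , refl , refl
  Untangle⇒AdjSwap (there {w} step) with Untangle⇒AdjSwap step
  ... | xs , a , b , ys , refl , refl = w ∷ xs , a , b , ys , refl , refl

  Untangle-precedes : ∀ {σ τ u v} → Untangle σ τ → Precedes τ u v →
                      Precedes σ u v ⊎ ¬ v ≤ᶠ u
  Untangle-precedes (here a≰b)   (here (here refl)) = inj₂ a≰b
  Untangle-precedes (here _)     (here (there v∈σ)) = inj₁ (there (here v∈σ))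
  Untangle-precedes (here _)     (there (here v∈σ)) = inj₁ (here (there v∈σ))
  Untangle-precedes (here _)     (there (there p))  = inj₁ (there (there p))
  Untangle-precedes (there step) (here v∈τ)         = inj₁ (here (∈-resp-↭ (Untangle⇒↭ step) v∈τ))
  Untangle-precedes (there step) (there p) with Untangle-precedes step p
  ... | inj₁ q   = inj₁ (there q)
  ... | inj₂ v≰u = inj₂ v≰u

  Untangle⇒InversionsIncluded : ∀ {σ τ} → Untangle σ τ → InversionsIncluded τ σ
  Untangle⇒InversionsIncluded step v<u above with Untangle-precedes step (Above⇒Precedes above)
  ... | inj₁ p   = Precedes⇒Above p
  ... | inj₂ v≰u = contradiction (<⇒≤ v<u) v≰u

  InDomain-untangle : ∀ {A σ τ} → InDomain A σ → Untangle σ τ → InDomain A τ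
  InDomain-untangle (σ↭ , sat) step =
    ↭-trans (Untangle⇒↭ step) σ↭ ,
    SatisfiesScheme-antitone (Untangle⇒InversionsIncluded step) sat

  untangling⇒ConnectedIn : ∀ {A σ τ} → InDomain A σ → Star Untangle σ τ → ConnectedIn A σ τ
  untangling⇒ConnectedIn _  ε              = ε
  untangling⇒ConnectedIn σ∈ (step ◅ steps) =
    (σ∈ , InDomain-untangle σ∈ step , Untangle⇒AdjSwap step)
      ◅ untangling⇒ConnectedIn (InDomain-untangle σ∈ step) steps

  sort-cong-↭ : ∀ {σ τ} → σ ↭ τ → sort σ ≡ sort τ
  sort-cong-↭ {σ} {τ} σ↭τ = ≋⇒≡ (↗↭↗⇒≋ (≤-totalOrder n) (sort-↗ σ) (sort-↗ τ)
    (↭⇒↭ₛ (↭-trans (sort-↭ σ) (↭-trans σ↭τ (↭-sym (sort-↭ τ))))))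

  sort-connected : ∀ {A σ} → InDomain A σ → ConnectedIn A σ (sort σ)
  sort-connected {σ = σ} σ∈ = untangling⇒ConnectedIn σ∈ (sort-untangling σ)

DomainStep-sym : ∀ {n} {A : Subset n} {σ τ} → DomainStep A σ τ → DomainStep A τ σ
DomainStep-sym (σ∈ , τ∈ , xs , a , b , ys , σ≡ , τ≡) = τ∈ , σ∈ , xs , b , a , ys , τ≡ , σ≡

-- The argument works for every n.
mainTheorem3 : (n : ℕ) → 1 ≤ n → (A : Subset n) → (x y : List (Fin n)) →
    InDomain A x → InDomain A y → ConnectedIn A x y
mainTheorem3 n _ A x y x∈ y∈ =
  subst (ConnectedIn A x) (sort-cong-↭ (↭-trans (proj₁ x∈) (↭-sym (proj₁ y∈))))
        (sort-connected x∈)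
    ◅◅ reverse DomainStep-sym (sort-connected y∈)
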